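{- Every hypergraph $\mathcal H$ satisfies $\alpha(\mathcal H)\ge \frac12+\frac{\alpha^*(\mathcal H)}{4\,\mathrm{aw}(\mathcal H)}$.
   Context: A hypergraph is a pair $(V,E)$ with $V$ finite and $E\subseteq 2^V\setminus\{\emptyset\}$. An independent set is a vertex set no two distinct elements of which lie in a common hyperedge; $\alpha(\mathcal H)$ is the maximum size of an independent set. A fractional independent set is $\mu:V(\mathcal H)\to[0,1]$ with $\sum_{v\in e}\mu(v)\le1$ for every hyperedge $e$; $\alpha^*(\mathcal H)$ is the maximum of $\sum_v\mu(v)$ over fractional independent sets. A tree decomposition is a tree $\mathcal T$ with bags $B_t\subseteq V(\mathcal H)$ such that every vertex lies in some bag, every hyperedge is contained in some bag, and for every vertex $v$ the nodes whose bags contain $v$ induce a connected subtree. For $\mu$ a fractional independent set, the $\mu$-width of a tree decomposition is $\max_t\sum_{v\in B_t}\mu(v)$, and the $\mu$-width of $\mathcal H$ is the minimum over tree decompositions. The adaptive width $\mathrm{aw}(\mathcal H)$ is the supremum of the $\mu$-width of $\mathcal H$ over all fractional independent sets $\mu$.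
   Formalization: The fractional independent sets $\mu$ take rational values rather than real ones, so $\alpha^*(\mathcal H)$ and $\mathrm{aw}(\mathcal H)$ are a maximum and a supremum over rational-valued $\mu$. -}

module Defs where

open import Data.Nat as ℕ using (ℕ; zero; suc)
open import Data.Fin using (Fin; zero; suc; toℕ)
open import Data.Fin.Subset using (Subset; _∈_; _⊆_; ⊤; Nonempty; ∣_∣)
open import Data.Vec using ([]; _∷_)
open import Data.Bool using (Bool; true; false; if_then_else_)
open import Data.List using (List)
open import Data.List.Membership.Propositional renaming (_∈_ to _∈ᴸ_)
open import Data.List.Relation.Unary.All using (All)
open import Data.Rational using (ℚ; 0ℚ; 1ℚ; _+_; _≤_)
open import Data.Product using (Σ; ∃; _×_; _,_; proj₁)
open import Data.Sum using (_⊎_)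
open import Relation.Binary.PropositionalEquality using (_≡_; _≢_)
open import Relation.Binary.Construct.Closure.ReflexiveTransitive using (Star)
open import Relation.Nullary using (¬_)

record Hypergraph : Set where
  field
    n        : ℕ
    edges    : List (Subset n)
    nonempty : All Nonempty edges
open Hypergraph public

weight : ∀ {n} → Subset n → (Fin n → ℚ) → ℚ
weight []          μ = 0ℚ
weight (b ∷ S) μ = (if b then μ zero else 0ℚ) + weight S (λ v → μ (suc v))

IsIndependent : (H : Hypergraph) → Subset (n H) → Set
IsIndependent H S = ∀ e → e ∈ᴸ edges H → ∀ u v → u ≢ v →
  u ∈ S → v ∈ S → ¬ (u ∈ e × v ∈ e)

IsIndependenceNumber : (H : Hypergraph) → ℕ → Set
IsIndependenceNumber H k =
  (Σ (Subset (n H)) λ S → IsIndependent H S × ∣ S ∣ ≡ k) ×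
  (∀ S → IsIndependent H S → ∣ S ∣ ℕ.≤ k)

IsFractionalIndependent : (H : Hypergraph) → (Fin (n H) → ℚ) → Set
IsFractionalIndependent H μ =
  (∀ v → 0ℚ ≤ μ v × μ v ≤ 1ℚ) × (∀ e → e ∈ᴸ edges H → weight e μ ≤ 1ℚ)

IsFractionalIndependenceNumber : (H : Hypergraph) → ℚ → Set
IsFractionalIndependenceNumber H a =
  (Σ (Fin (n H) → ℚ) λ μ → IsFractionalIndependent H μ × weight ⊤ μ ≡ a) ×
  (∀ μ → IsFractionalIndependent H μ → weight ⊤ μ ≤ a)

-- A (finite, nonempty) tree on nodes Fin (suc k): node (suc i) has a parent
-- whose index is ≤ i.  Every finite tree can be presented this way.
record TreeDecomposition (H : Hypergraph) : Set where
  field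
    k      : ℕ
    parent : (i : Fin k) → Σ (Fin (suc k)) λ j → toℕ j ℕ.≤ toℕ i
    bag    : Fin (suc k) → Subset (n H)

  Adj : Fin (suc k) → Fin (suc k) → Set
  Adj a b = (∃ λ i → a ≡ suc i × b ≡ proj₁ (parent i))
          ⊎ (∃ λ i → b ≡ suc i × a ≡ proj₁ (parent i))

  Step : Fin (n H) → Fin (suc k) → Fin (suc k) → Set
  Step v a b = Adj a b × v ∈ bag a × v ∈ bag b

  field
    coversVertices : ∀ v → ∃ λ t → v ∈ bag t
    coversEdges    : ∀ e → e ∈ᴸ edges H → ∃ λ t → e ⊆ bag t
    connected      : ∀ v s t → v ∈ bag s → v ∈ bag t → Star (Step v) s t
open TreeDecomposition public

WidthAtMost : {H : Hypergraph} → TreeDecomposition H → (Fin (n H) → ℚ) → ℚ → Set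
WidthAtMost T μ c = ∀ t → weight (bag T t) μ ≤ c

μWidthAtMost : (H : Hypergraph) → (Fin (n H) → ℚ) → ℚ → Set
μWidthAtMost H μ c = Σ (TreeDecomposition H) λ T → WidthAtMost T μ c

AwUpperBound : Hypergraph → ℚ → Set
AwUpperBound H c = ∀ μ → IsFractionalIndependent H μ → μWidthAtMost H μ c

IsAdaptiveWidth : Hypergraph → ℚ → Set
IsAdaptiveWidth H w = AwUpperBound H w × (∀ c → AwUpperBound H c → w ≤ c)

{-# OPTIONS --safe #-}
-- Take a fractional independent set μ of total weight α* and a tree decomposition of μ-width
-- at most aw, with nodes indexed so that parents precede children.  Sweep the nodes from the
-- last to the first.  At node t, if some remaining vertex u has t as its topmost bag, put u
-- into S and delete all of B_t from the remaining vertices; this costs at most aw of weight.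
-- A remaining vertex sharing a hyperedge with u has a bag in the subtree of t and, lying in an
-- earlier bag, also in B_t; so it has been deleted and S is independent.  Hence
-- α* ≤ |S|·aw ≤ α·aw, and α ≥ 1 turns this into the stated bound.
module Submission where

open import Defs
open import Data.Nat as ℕ using (ℕ)
open import Data.Integer using (+_)
open import Data.Rational using (ℚ; _+_; _*_; _÷_; _/_; _≤_; ½; NonZero)

import Data.Nat.Properties as ℕ
import Data.Nat.Coprimality as Coprime
import Data.Integer as ℤ
import Data.Integer.Properties as ℤ
open import Data.Rational using (0ℚ; 1ℚ; mkℚ; 1/_; *≤*; nonNegative)
open import Data.Rational.Properties
  using (normalize-coprime; /-cong; ≤-refl; ≤-reflexive; ≤-trans; _≤?_; +-mono-≤;
         +-comm; +-identityˡ; +-identityʳ; *-assoc; *-identityˡ; *-identityʳ; *-zeroˡ;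
         *-distribʳ-+; *-inverseˡ; *-monoˡ-≤-nonNeg; *-monoʳ-≤-nonNeg; *-cancelʳ-≤-pos;
         nonNeg∧nonZero⇒pos; +-0-commutativeMonoid; module ≤-Reasoning)
open import Data.Fin using (Fin; zero; suc; toℕ; fromℕ<)
open import Data.Fin.Properties using (_≟_; any?; toℕ<n; toℕ-injective; toℕ-fromℕ<)
open import Data.Fin.Subset using (Subset; _∈_; _∉_; _⊆_; ⊤; ⊥; ∣_∣; ⁅_⁆; _∪_; _─_; inside; outside)
open import Data.Fin.Subset.Properties
  using (_∈?_; ∉⊥; ∣⊥∣≡0; ∣⁅x⁆∣≡1; Empty-unique; x∈⁅x⁆; x∈⁅y⁆⇒x≡y; x∈p∪q⁻; x∈p∪q⁺;
         q⊆p∪q; p─q⊆p; p⊂q⇒∣p∣<∣q∣)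
open import Data.Vec using (_∷_; []; here; there)
open import Data.Bool using (true; false; if_then_else_)
open import Data.List.Membership.Propositional using () renaming (_∈_ to _∈ᴸ_)
open import Data.Product using (Σ; ∃; _×_; _,_; proj₁; proj₂)
open import Data.Sum using (_⊎_; inj₁; inj₂)
open import Function using (_∘_)
open import Relation.Nullary using (¬_; Dec; yes; no; contradiction)
open import Relation.Nullary.Decidable using (_×-dec_; ¬?; toWitness; decidable-stable)
open import Relation.Binary.PropositionalEquality
open import Relation.Binary.Construct.Closure.ReflexiveTransitive using (Star; ε; _◅_)
open import Algebra.Bundles using (CommutativeMonoid)
open import Algebra.Properties.CommutativeSemigroup
  (CommutativeMonoid.commutativeSemigroup +-0-commutativeMonoid) using (interchange)

+/1≡mkℚ : ∀ m → + m / 1 ≡ mkℚ (+ m) 0 (Coprime.sym (Coprime.1-coprimeTo m))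
+/1≡mkℚ m = normalize-coprime (Coprime.sym (Coprime.1-coprimeTo m))

+/1-mono-≤ : ∀ {m n} → m ℕ.≤ n → + m / 1 ≤ + n / 1
+/1-mono-≤ {m} {n} m≤n rewrite +/1≡mkℚ m | +/1≡mkℚ n =
  *≤* (ℤ.*-monoʳ-≤-nonNeg (+ 1) (ℤ.+≤+ m≤n))

+/1-suc : ∀ m → + ℕ.suc m / 1 ≡ 1ℚ + + m / 1
+/1-suc m rewrite +/1≡mkℚ m =
  sym (/-cong {p₁ = + 1 ℤ.* + 1 ℤ.+ + m ℤ.* + 1} (cong (ℤ._+_ (+ 1)) (ℤ.*-identityʳ (+ m))) refl)

+/1-suc-* : ∀ m w → (+ ℕ.suc m / 1) * w ≡ (+ m / 1) * w + w
+/1-suc-* m w = begin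
  (+ ℕ.suc m / 1) * w       ≡⟨ cong (_* w) (+/1-suc m) ⟩
  (1ℚ + + m / 1) * w        ≡⟨ *-distribʳ-+ w 1ℚ (+ m / 1) ⟩
  1ℚ * w + (+ m / 1) * w    ≡⟨ cong (_+ (+ m / 1) * w) (*-identityˡ w) ⟩
  w + (+ m / 1) * w         ≡⟨ +-comm w _ ⟩
  (+ m / 1) * w + w         ∎
  where open ≡-Reasoning

p≤q*r⇒p÷r≤q : ∀ {p q} r .{{_ : NonZero r}} → 0ℚ ≤ r → p ≤ q * r → p ÷ r ≤ q
p≤q*r⇒p÷r≤q {p} {q} r r≥0 p≤qr =
  *-cancelʳ-≤-pos r {{nonNeg∧nonZero⇒pos r {{nonNegative r≥0}}}} (begin
  p * 1/ r * r    ≡⟨ *-assoc p (1/ r) r ⟩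
  p * (1/ r * r)  ≡⟨ cong (p *_) (*-inverseˡ r) ⟩
  p * 1ℚ          ≡⟨ *-identityʳ p ⟩
  p               ≤⟨ p≤qr ⟩
  q * r           ∎)
  where open ≤-Reasoning

½+¼p≤q : ∀ {p q} → p ≤ q → 1ℚ ≤ q → ½ + (+ 1 / 4) * p ≤ q
½+¼p≤q {p} {q} p≤q 1≤q = begin
  ½ + (+ 1 / 4) * p                ≤⟨ +-mono-≤ ½≤¾q (*-monoˡ-≤-nonNeg (+ 1 / 4) p≤q) ⟩
  (+ 3 / 4) * q + (+ 1 / 4) * q    ≡⟨ *-distribʳ-+ q (+ 3 / 4) (+ 1 / 4) ⟨
  1ℚ * q                           ≡⟨ *-identityˡ q ⟩
  q                                ∎
  where
  open ≤-Reasoning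
  ½≤¾q : ½ ≤ (+ 3 / 4) * q
  ½≤¾q = ≤-trans (toWitness {a? = ½ ≤? + 3 / 4} _) (*-monoˡ-≤-nonNeg (+ 3 / 4) 1≤q)

≤-+-interchange : ∀ {a b : ℚ} c d e f → a ≤ c + e → b ≤ d + f → a + b ≤ (c + d) + (e + f)
≤-+-interchange c d e f a≤c+e b≤d+f =
  ≤-trans (+-mono-≤ a≤c+e b≤d+f) (≤-reflexive (interchange c e d f))

weight-nonNeg : ∀ {n} (S : Subset n) {μ : Fin n → ℚ} → (∀ v → 0ℚ ≤ μ v) → 0ℚ ≤ weight S μ
weight-nonNeg []          μ≥0 = ≤-refl
weight-nonNeg (true ∷ S)  μ≥0 = +-mono-≤ (μ≥0 zero) (weight-nonNeg S (μ≥0 ∘ suc))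
weight-nonNeg (false ∷ S) μ≥0 = +-mono-≤ ≤-refl (weight-nonNeg S (μ≥0 ∘ suc))

weight-⊥ : ∀ {n} (μ : Fin n → ℚ) → weight ⊥ μ ≡ 0ℚ
weight-⊥ {ℕ.zero}  μ = refl
weight-⊥ {ℕ.suc n} μ = cong (_+_ 0ℚ) (weight-⊥ (μ ∘ suc))

weight-≤-─+ : ∀ {n} (R B : Subset n) {μ : Fin n → ℚ} → (∀ v → 0ℚ ≤ μ v) →
              weight R μ ≤ weight (R ─ B) μ + weight B μ
weight-≤-─+ []      []            μ≥0 = ≤-refl
weight-≤-─+ (r ∷ R) (inside ∷ B)  {μ} μ≥0 =
  ≤-+-interchange 0ℚ (weight (R ─ B) (μ ∘ suc)) (μ zero) (weight B (μ ∘ suc))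
    (if≤0+ r (μ≥0 zero)) (weight-≤-─+ R B (μ≥0 ∘ suc))
  where
  if≤0+ : ∀ r {x} → 0ℚ ≤ x → (if r then x else 0ℚ) ≤ 0ℚ + x
  if≤0+ true  {x} _   = ≤-reflexive (sym (+-identityˡ x))
  if≤0+ false     x≥0 = +-mono-≤ ≤-refl x≥0
weight-≤-─+ (r ∷ R) (outside ∷ B) {μ} μ≥0 =
  ≤-+-interchange (if r then μ zero else 0ℚ) (weight (R ─ B) (μ ∘ suc)) 0ℚ (weight B (μ ∘ suc))
    (≤-reflexive (sym (+-identityʳ (if r then μ zero else 0ℚ)))) (weight-≤-─+ R B (μ≥0 ∘ suc))

x∈p─q⇒x∉q : ∀ {n} {x : Fin n} (p q : Subset n) → x ∈ p ─ q → x ∉ q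
x∈p─q⇒x∉q (inside ∷ p) (outside ∷ q) here      ()
x∈p─q⇒x∉q (_ ∷ p)      (_ ∷ q)       (there i) (there j) = x∈p─q⇒x∉q p q i j

x∉p⇒∣p∣<∣⁅x⁆∪p∣ : ∀ {n} {x : Fin n} {p : Subset n} → x ∉ p → ∣ p ∣ ℕ.< ∣ ⁅ x ⁆ ∪ p ∣
x∉p⇒∣p∣<∣⁅x⁆∪p∣ {x = x} {p} x∉p = p⊂q⇒∣p∣<∣q∣ (q⊆p∪q ⁅ x ⁆ p , x , x∈p∪q⁺ (inj₁ (x∈⁅x⁆ x)) , x∉p)

⁅x⁆-independent : ∀ H (x : Fin (n H)) → IsIndependent H ⁅ x ⁆
⁅x⁆-independent H x _ _ a b a≢b a∈x b∈x _ = a≢b (trans (x∈⁅y⁆⇒x≡y x a∈x) (sym (x∈⁅y⁆⇒x≡y x b∈x)))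

⁅x⁆∪-independent : ∀ H {S} u → IsIndependent H S →
  (∀ x → x ∈ S → ∀ e → e ∈ᴸ edges H → ¬ (u ∈ e × x ∈ e)) → IsIndependent H (⁅ u ⁆ ∪ S)
⁅x⁆∪-independent H {S} u S-indep separated e e∈E a b a≢b a∈ b∈
  with x∈p∪q⁻ ⁅ u ⁆ S a∈ | x∈p∪q⁻ ⁅ u ⁆ S b∈
... | inj₁ a∈u | inj₁ b∈u = λ _ → a≢b (trans (x∈⁅y⁆⇒x≡y u a∈u) (sym (x∈⁅y⁆⇒x≡y u b∈u)))
... | inj₁ a∈u | inj₂ b∈S rewrite x∈⁅y⁆⇒x≡y u a∈u = separated b b∈S e e∈E
... | inj₂ a∈S | inj₁ b∈u rewrite x∈⁅y⁆⇒x≡y u b∈u = λ (a∈e , u∈e) → separated a a∈S e e∈E (u∈e , a∈e)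
... | inj₂ a∈S | inj₂ b∈S = S-indep e e∈E a b a≢b a∈S b∈S

1≤α : ∀ H {k} → 0 ℕ.< n H → IsIndependenceNumber H k → 1 ℕ.≤ k
1≤α H n>0 (_ , α-max) = subst (ℕ._≤ _) (∣⁅x⁆∣≡1 x) (α-max ⁅ x ⁆ (⁅x⁆-independent H x))
  where
  x : Fin (n H)
  x = fromℕ< n>0

module _ {H : Hypergraph} (T : TreeDecomposition H) where

  Node : Set
  Node = Fin (ℕ.suc (k T))

  par : Fin (k T) → Node
  par i = proj₁ (parent T i)

  par≤ : ∀ i → toℕ (par i) ℕ.≤ toℕ i
  par≤ i = proj₂ (parent T i)

  data Descendant (t : Node) : Node → Set where
    self  : Descendant t t
    child : ∀ i → Descendant t (par i) → Descendant t (suc i)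

  descendant⇒≤ : ∀ {t x} → Descendant t x → toℕ t ℕ.≤ toℕ x
  descendant⇒≤ self        = ℕ.≤-refl
  descendant⇒≤ (child i d) = ℕ.≤-trans (descendant⇒≤ d) (ℕ.≤-trans (par≤ i) (ℕ.n≤1+n _))

  descendant? : ∀ t x → Dec (Descendant t x)
  descendant? t x = bounded (toℕ x) x ℕ.≤-refl
    where
    bounded : ∀ b x → toℕ x ℕ.≤ b → Dec (Descendant t x)
    bounded b x _ with x ≟ t
    ... | yes refl = yes self
    bounded b zero _ | no x≢t = no λ { self → x≢t refl }
    bounded (ℕ.suc b) (suc i) i<b | no x≢t with bounded b (par i) (ℕ.≤-trans (par≤ i) (ℕ.≤-pred i<b))
    ... | yes d  = yes (child i d)
    ... | no ¬d = no λ { self → x≢t refl ; (child .i d) → ¬d d }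

  leave-subtree : ∀ {v} t {a b} → Star (Step T v) a b → Descendant t a → ¬ Descendant t b →
                  ∃ λ i → t ≡ suc i × v ∈ bag T t × v ∈ bag T (par i)
  leave-subtree t ε                                        t≼a        t⋠b = contradiction t≼a t⋠b
  leave-subtree t ((inj₁ (i , refl , refl) , v∈t , v∈par) ◅ _) self     t⋠b = i , refl , v∈t , v∈par
  leave-subtree t ((inj₁ (i , refl , refl) , _ , _) ◅ walk)  (child i d) t⋠b = leave-subtree t walk d t⋠b
  leave-subtree t ((inj₂ (i , refl , refl) , _ , _) ◅ walk)  t≼a        t⋠b =
    leave-subtree t walk (child i t≼a) t⋠b

  InBagBelow : ℕ → Fin (n H) → Set
  InBagBelow m x = ∃ λ j → toℕ j ℕ.< m × x ∈ bag T j

  ¬InBagBelow-0 : ∀ {x} → ¬ InBagBelow 0 x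
  ¬InBagBelow-0 (_ , () , _)

  inBagBelow? : ∀ m x → Dec (InBagBelow m x)
  inBagBelow? m x = any? (λ j → (toℕ j ℕ.<? m) ×-dec (x ∈? bag T j))

  inBagBelow-suc : ∀ t {x} → InBagBelow (ℕ.suc (toℕ t)) x → x ∈ bag T t ⊎ InBagBelow (toℕ t) x
  inBagBelow-suc t (j , j≤t , x∈j) with ℕ.m<1+n⇒m<n∨m≡n j≤t
  ... | inj₁ j<t = inj₂ (j , j<t , x∈j)
  ... | inj₂ j≡t = inj₁ (subst (λ s → _ ∈ bag T s) (toℕ-injective j≡t) x∈j)

  -- The bag holding e lies either in the subtree of t, and then the walk of x to its earlier
  -- bag B_j leaves that subtree through B_t, or outside it, and then the walk of u leaves the
  -- subtree through the parent of t, an earlier bag than B_t.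
  separated-by-top-bag : ∀ {t u x e} → u ∈ bag T t → ¬ InBagBelow (toℕ t) u →
    x ∉ bag T t → InBagBelow (toℕ t) x → e ∈ᴸ edges H → ¬ (u ∈ e × x ∈ e)
  separated-by-top-bag {t} {u} {x} {e} u∈t u-top x∉t (j , j<t , x∈j) e∈E (u∈e , x∈e)
    with coversEdges T e e∈E
  ... | s , e⊆s with descendant? t s
  ... | yes t≼s = x∉t (proj₁ (proj₂ (proj₂ (leave-subtree t x-walk t≼s t⋠j))))
    where
    x-walk : Star (Step T x) s j
    x-walk = connected T x s j (e⊆s x∈e) x∈j
    t⋠j : ¬ Descendant t j
    t⋠j t≼j = ℕ.<⇒≱ j<t (descendant⇒≤ t≼j)
  ... | no t⋠s with leave-subtree t (connected T u t s u∈t (e⊆s u∈e)) self t⋠s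
  ... | i , refl , _ , u∈par = u-top (par i , ℕ.s≤s (par≤ i) , u∈par)

  CoveredBelow : ℕ → Subset (n H) → Set
  CoveredBelow m R = ∀ x → x ∈ R → InBagBelow m x

  CoveredBelow-⊤ : CoveredBelow (ℕ.suc (k T)) ⊤
  CoveredBelow-⊤ x _ with coversVertices T x
  ... | j , x∈j = j , toℕ<n j , x∈j

  CoveredBelow-─-bag : ∀ t R → CoveredBelow (ℕ.suc (toℕ t)) R → CoveredBelow (toℕ t) (R ─ bag T t)
  CoveredBelow-─-bag t R covered x x∈R′ with inBagBelow-suc t (covered x (p─q⊆p R (bag T t) x∈R′))
  ... | inj₁ x∈t   = contradiction x∈t (x∈p─q⇒x∉q R (bag T t) x∈R′)
  ... | inj₂ below = below

  width-nonNeg : ∀ {μ w} → (∀ v → 0ℚ ≤ μ v) → WidthAtMost T μ w → 0ℚ ≤ w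
  width-nonNeg μ≥0 width = ≤-trans (weight-nonNeg (bag T zero) μ≥0) (width zero)

  module _ {μ : Fin (n H) → ℚ} (μ≥0 : ∀ v → 0ℚ ≤ μ v) {w : ℚ} (width : WidthAtMost T μ w) where

    BoundedByIndependent : Subset (n H) → Set
    BoundedByIndependent R =
      Σ (Subset (n H)) λ S → S ⊆ R × IsIndependent H S × weight R μ ≤ (+ ∣ S ∣ / 1) * w

    empty-bounded : ∀ R → CoveredBelow 0 R → BoundedByIndependent R
    empty-bounded R covered =
      ⊥ , (λ x∈⊥ → contradiction x∈⊥ ∉⊥) , (λ _ _ _ _ _ x∈⊥ → contradiction x∈⊥ ∉⊥) , bound
      where
      bound : weight R μ ≤ (+ ∣ ⊥ {n H} ∣ / 1) * w
      bound rewrite Empty-unique {p = R} (λ (x , x∈R) → ¬InBagBelow-0 (covered x x∈R))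
                  | weight-⊥ μ | ∣⊥∣≡0 (n H) = ≤-reflexive (sym (*-zeroˡ w))

    add-top-vertex : ∀ t R {u} → CoveredBelow (ℕ.suc (toℕ t)) R → u ∈ R → u ∈ bag T t →
      ¬ InBagBelow (toℕ t) u → BoundedByIndependent (R ─ bag T t) → BoundedByIndependent R
    add-top-vertex t R {u} covered u∈R u∈t u-top (S , S⊆R′ , S-indep , S-bound) =
      ⁅ u ⁆ ∪ S , ⁅u⁆∪S⊆R , ⁅x⁆∪-independent H u S-indep separated , bound
      where
      separated : ∀ x → x ∈ S → ∀ e → e ∈ᴸ edges H → ¬ (u ∈ e × x ∈ e)
      separated x x∈S _ = separated-by-top-bag u∈t u-top (x∈p─q⇒x∉q R (bag T t) (S⊆R′ x∈S))
        (CoveredBelow-─-bag t R covered x (S⊆R′ x∈S))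

      ⁅u⁆∪S⊆R : ⁅ u ⁆ ∪ S ⊆ R
      ⁅u⁆∪S⊆R x∈ with x∈p∪q⁻ ⁅ u ⁆ S x∈
      ... | inj₁ x∈u = subst (_∈ R) (sym (x∈⁅y⁆⇒x≡y u x∈u)) u∈R
      ... | inj₂ x∈S = p─q⊆p R (bag T t) (S⊆R′ x∈S)

      u∉S : u ∉ S
      u∉S u∈S = x∈p─q⇒x∉q R (bag T t) (S⊆R′ u∈S) u∈t

      bound : weight R μ ≤ (+ ∣ ⁅ u ⁆ ∪ S ∣ / 1) * w
      bound = begin
        weight R μ                                 ≤⟨ weight-≤-─+ R (bag T t) μ≥0 ⟩
        weight (R ─ bag T t) μ + weight (bag T t) μ ≤⟨ +-mono-≤ S-bound (width t) ⟩
        (+ ∣ S ∣ / 1) * w + w                      ≡⟨ +/1-suc-* ∣ S ∣ w ⟨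
        (+ ℕ.suc ∣ S ∣ / 1) * w                    ≤⟨ *-monoʳ-≤-nonNeg w {{nonNegative (width-nonNeg μ≥0 width)}}
                                                        (+/1-mono-≤ (x∉p⇒∣p∣<∣⁅x⁆∪p∣ u∉S)) ⟩
        (+ ∣ ⁅ u ⁆ ∪ S ∣ / 1) * w                  ∎
        where open ≤-Reasoning

    bounded-by-independent-step : ∀ t R → CoveredBelow (ℕ.suc (toℕ t)) R →
      (∀ R′ → CoveredBelow (toℕ t) R′ → BoundedByIndependent R′) → BoundedByIndependent R
    bounded-by-independent-step t R covered below with any? (λ u → (u ∈? R) ×-dec ¬? (inBagBelow? (toℕ t) u))
    ... | yes (u , u∈R , u-top) with inBagBelow-suc t (covered u u∈R)
    ...   | inj₁ u∈t   = add-top-vertex t R covered u∈R u∈t u-top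
                           (below (R ─ bag T t) (CoveredBelow-─-bag t R covered))
    ...   | inj₂ u-low = contradiction u-low u-top
    bounded-by-independent-step t R covered below | no ∄top = below R λ x x∈R →
      decidable-stable (inBagBelow? (toℕ t) x) (λ x-top → ∄top (x , x∈R , x-top))

    bounded-by-independent : ∀ m → m ℕ.≤ ℕ.suc (k T) → ∀ R → CoveredBelow m R → BoundedByIndependent R
    bounded-by-independent ℕ.zero    _   = empty-bounded
    bounded-by-independent (ℕ.suc m) m<K R covered with fromℕ< m<K | toℕ-fromℕ< m<K
    ... | t | refl =
      bounded-by-independent-step t R covered (bounded-by-independent (toℕ t) (ℕ.<⇒≤ m<K))

weight≤α*width : ∀ {H k μ w} (T : TreeDecomposition H) → (∀ v → 0ℚ ≤ μ v) → WidthAtMost T μ w →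
                 IsIndependenceNumber H k → weight ⊤ μ ≤ (+ k / 1) * w
weight≤α*width {H} T μ≥0 width (_ , α-max)
  with bounded-by-independent T μ≥0 width _ ℕ.≤-refl ⊤ (CoveredBelow-⊤ T)
... | S , _ , S-indep , S-bound = ≤-trans S-bound
  (*-monoʳ-≤-nonNeg _ {{nonNegative (width-nonNeg T μ≥0 width)}} (+/1-mono-≤ (α-max S S-indep)))

theorem3 : (H : Hypergraph) → 0 ℕ.< n H →
    (k : ℕ) (a w : ℚ) → IsIndependenceNumber H k →
    IsFractionalIndependenceNumber H a → IsAdaptiveWidth H w →
    .{{_ : NonZero w}} →
    ½ + (+ 1 / 4) * (a ÷ w) ≤ + k / 1
theorem3 H n>0 k a w α≡k ((μ , μ-frac , μ-total) , _) (aw-bound , _) =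
  ½+¼p≤q (p≤q*r⇒p÷r≤q w (width-nonNeg T μ≥0 width) a≤k*w) (+/1-mono-≤ (1≤α H n>0 α≡k))
  where
  μ≥0 : ∀ v → 0ℚ ≤ μ v
  μ≥0 v = proj₁ (proj₁ μ-frac v)
  T : TreeDecomposition H
  T = proj₁ (aw-bound μ μ-frac)
  width : WidthAtMost T μ w
  width = proj₂ (aw-bound μ μ-frac)
  a≤k*w : a ≤ (+ k / 1) * w
  a≤k*w = subst (_≤ (+ k / 1) * w) μ-total (weight≤α*width T μ≥0 width α≡k)
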